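{- For every connected graph $G$ of order $n$ with $m$ edges and maximum degree $\Delta$, we have ${\rm I}_e(G)\leq \left\lfloor \frac{m}{2}\right\rfloor + n+\Delta-2$.
   Context: All graphs are finite and simple. A graph is locally irregular if no two adjacent vertices have the same degree. For a graph $G=(V,E)$, a set $S\subseteq E$ is an edge-irregulator of $G$ if $G-S$ is locally irregular, and ${\rm I}_e(G)$ is the minimum cardinality of an edge-irregulator of $G$. -}

module Defs where

open import Data.Nat using (ℕ; zero; suc; _+_; _⊔_; _<_)
open import Data.Bool using (Bool; true; false; _∧_; not; if_then_else_)
open import Data.Fin using (Fin; toℕ) renaming (zero to fzero; suc to fsuc)
open import Data.Nat using (_<ᵇ_)
open import Relation.Binary.PropositionalEquality using (_≡_)
open import Relation.Nullary using (¬_)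
open import Data.Product using (Σ; _×_)

record Graph (n : ℕ) : Set where
  field
    adj    : Fin n → Fin n → Bool
    sym    : ∀ i j → adj i j ≡ adj j i
    irrefl : ∀ i → adj i i ≡ false
open Graph public

count : ∀ {n} → (Fin n → Bool) → ℕ
count {zero}  p = 0
count {suc n} p = (if p fzero then 1 else 0) + count (λ x → p (fsuc x))

maxOf : ∀ {n} → (Fin n → ℕ) → ℕ
maxOf {zero}  f = 0
maxOf {suc n} f = f fzero ⊔ maxOf (λ x → f (fsuc x))

degA : ∀ {n} → (Fin n → Fin n → Bool) → Fin n → ℕ
degA a v = count (a v)

pairCount : ∀ {n} → (Fin n → Fin n → Bool) → ℕ
pairCount {n} r = sumF (λ i → count (λ j → (toℕ i <ᵇ toℕ j) ∧ r i j))
  where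
  sumF : ∀ {k} → (Fin k → ℕ) → ℕ
  sumF {zero}  f = 0
  sumF {suc k} f = f fzero + sumF (λ x → f (fsuc x))

deg : ∀ {n} → Graph n → Fin n → ℕ
deg G = degA (adj G)

order : ∀ {n} → Graph n → ℕ
order {n} _ = n

size : ∀ {n} → Graph n → ℕ
size G = pairCount (adj G)

maxDeg : ∀ {n} → Graph n → ℕ
maxDeg G = maxOf (deg G)

data Walk {n : ℕ} (G : Graph n) : Fin n → Fin n → Set where
  here : ∀ {v} → Walk G v v
  step : ∀ {u v w} → adj G u v ≡ true → Walk G v w → Walk G u w

Connected : ∀ {n} → Graph n → Set
Connected {n} G = ∀ (u v : Fin n) → Walk G u v

record EdgeSet {n : ℕ} (G : Graph n) : Set where
  field
    mem    : Fin n → Fin n → Bool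
    memSym : ∀ i j → mem i j ≡ mem j i
    sub    : ∀ i j → mem i j ≡ true → adj G i j ≡ true
open EdgeSet public

card : ∀ {n} {G : Graph n} → EdgeSet G → ℕ
card S = pairCount (mem S)

minusAdj : ∀ {n} (G : Graph n) → EdgeSet G → Fin n → Fin n → Bool
minusAdj G S i j = adj G i j ∧ not (mem S i j)

LocallyIrregularA : ∀ {n} → (Fin n → Fin n → Bool) → Set
LocallyIrregularA {n} a = ∀ (i j : Fin n) → a i j ≡ true → ¬ (degA a i ≡ degA a j)

IsEdgeIrregulator : ∀ {n} (G : Graph n) → EdgeSet G → Set
IsEdgeIrregulator G S = LocallyIrregularA (minusAdj G S)

-- "I_e(G) ≤ k": I_e is the minimum cardinality of an edge-irregulator; one always
-- exists (S = E(G)), so I_e(G) ≤ k iff some edge-irregulator has cardinality ≤ k.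
open import Data.Nat using (_≤_)
IeAtMost : ∀ {n} → Graph n → ℕ → Set
IeAtMost G k = Σ (EdgeSet G) (λ S → IsEdgeIrregulator G S × card S ≤ k)

{-# OPTIONS --safe #-}
-- Fix a 2-colouring `side` with the maximum number of cut edges.  Moving one vertex cannot
-- enlarge the cut, so at most ⌊m/2⌋ edges are uncut; and an edge leaving a vertex set R forces
-- a cut edge leaving R, so the cut graph H is connected.  H is bipartite, so if one side is
-- asked for odd degrees and the other for even degrees, adjacent vertices end up with different
-- degrees.  In a subtree of H on k vertices such parities can be reached by deleting fewer than
-- k tree edges once the number of odd demands is even (handshake lemma).  If a side of the
-- colouring has even size, use a spanning tree: ⌊m/2⌋ + n − 1 deletions.  Otherwise take a
-- subtree on all vertices but one, x, delete the at most Δ edges at x, and count x on the odd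
-- side, which leaves an even number of odd demands: ⌊m/2⌋ + Δ + n − 2 deletions.  As Δ ≥ 1
-- both are within ⌊m/2⌋ + n + Δ − 2.
module Submission where

open import Defs hiding (sym)
open import Data.Nat
  using (ℕ; zero; suc; pred; _+_; _*_; _∸_; _/_; _≤_; _<_; _<ᵇ_; z≤n; s≤s)
open import Data.Nat.Properties
  using (≤-refl; ≤-trans; ≤-reflexive; ≤-total; ≤-pred; <-irrefl; <-cmp; <⇒≱; _<?_;
         n<1+n; n≤1+n; suc-injective; suc[m]≤n⇒m≤pred[n]; +-identityʳ; +-comm; +-assoc; +-suc;
         +-mono-≤; +-mono-<-≤; +-mono-≤-<; +-monoʳ-≤; +-monoˡ-≤; +-cancelʳ-≤; *-comm; *-cancelˡ-≡;
         *-cancelˡ-≤; m≤m⊔n; m≤n⊔m; +-0-commutativeMonoid; module ≤-Reasoning)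
open import Data.Bool using (Bool; true; false; _∧_; _∨_; not; _xor_; if_then_else_)
open import Data.Bool.Properties
  using (∧-comm; ∨-comm; ∨-zeroʳ; ∧-zeroʳ; ∧-identityʳ; ∨-identityʳ; xor-same; xor-comm;
         xor-assoc; not-distribˡ-xor; not-distribʳ-xor; xor-annihilates-not; xor-identityʳ;
         not-involutive; not-injective; not-¬; ¬-not; xor-inverseʳ)
  renaming (_≟_ to _≟ᵇ_)
open import Data.Fin using (Fin; toℕ; zero; suc)
open import Data.Fin.Properties using (_≟_; toℕ-injective; any?)
open import Data.Vec using (Vec; []; _∷_; lookup; tabulate)
open import Data.Vec.Properties using (lookup∘tabulate)
open import Data.Product using (∃; ∃₂; _×_; _,_; proj₁; proj₂)
open import Data.Sum using (_⊎_; inj₁; inj₂)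
open import Data.Empty using (⊥-elim)
open import Function using (_∘_)
open import Relation.Binary.Definitions using (tri<; tri≈; tri>)
open import Relation.Binary.PropositionalEquality
  using (_≡_; _≢_; refl; sym; trans; cong; cong₂; subst; subst₂; module ≡-Reasoning)
open import Relation.Nullary using (¬_; Dec; yes; no; does)
open import Relation.Nullary.Decidable using (dec-true; dec-false; _×-dec_)
open import Algebra.Properties.CommutativeMonoid.Sum +-0-commutativeMonoid
  using (sum; sum-cong-≗; sum-replicate-zero; ∑-distrib-+; ∑-comm)
open import Data.Nat.DivMod using (m*n/n≡m; /-monoˡ-≤)

Adj : ℕ → Set
Adj n = Fin n → Fin n → Bool

Symmetric : ∀ {n} → Adj n → Set
Symmetric r = ∀ i j → r i j ≡ r j i

Irreflexive : ∀ {n} → Adj n → Set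
Irreflexive r = ∀ i → r i i ≡ false

_⊆_ : ∀ {k} → (Fin k → Bool) → (Fin k → Bool) → Set
p ⊆ q = ∀ x → p x ≡ true → q x ≡ true

_⇒_ : ∀ {n} → Adj n → Adj n → Set
r ⇒ s = ∀ i → r i ⊆ s i

_≡ᵇ_ : ∀ {n} → Fin n → Fin n → Bool
i ≡ᵇ j = does (i ≟ j)

∧-true⁻ : ∀ {x y} → x ∧ y ≡ true → x ≡ true × y ≡ true
∧-true⁻ {true} y≡true = refl , y≡true

xor-true⁻ : ∀ {x y} → x xor y ≡ true → x ≡ true ⊎ y ≡ true
xor-true⁻ {true}  _ = inj₁ refl
xor-true⁻ {false} y≡true = inj₂ y≡true

≡ᵇ-sound : ∀ {n} {i j : Fin n} → i ≡ᵇ j ≡ true → i ≡ j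
≡ᵇ-sound {i = i} {j} e with i ≟ j
... | yes i≡j = i≡j

xor-true-⊆ : ∀ {a b} → (b ≡ true → a ≡ true) → a xor b ≡ true → a ≡ true
xor-true-⊆ {true}  _   _ = refl
xor-true-⊆ {false} b⇒a b = b⇒a b

true≢false : true ≢ false
true≢false ()

-- Counting over Fin

indicator : Bool → ℕ
indicator b = if b then 1 else 0

indicator-mono : ∀ {a b} → (a ≡ true → b ≡ true) → indicator a ≤ indicator b
indicator-mono {false} _ = z≤n
indicator-mono {true}  a⇒b rewrite a⇒b refl = ≤-refl

indicator-< : ∀ {a b} → a ≡ false → b ≡ true → indicator a < indicator b
indicator-< refl refl = s≤s z≤n

indicator-split : ∀ a b → indicator a ≡ indicator (a ∧ b) + indicator (a ∧ not b)
indicator-split false _     = refl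
indicator-split true  true  = refl
indicator-split true  false = refl

count≡∑ : ∀ {k} (p : Fin k → Bool) → count p ≡ sum (indicator ∘ p)
count≡∑ {zero}  p = refl
count≡∑ {suc k} p = cong (indicator (p zero) +_) (count≡∑ (p ∘ suc))

count-cong : ∀ {k} {p q : Fin k → Bool} → (∀ x → p x ≡ q x) → count p ≡ count q
count-cong {p = p} {q} p≗q =
  trans (count≡∑ p) (trans (sum-cong-≗ (cong indicator ∘ p≗q)) (sym (count≡∑ q)))

count-+ : ∀ {k} {p q r : Fin k → Bool} →
  (∀ x → indicator (p x) ≡ indicator (q x) + indicator (r x)) → count p ≡ count q + count r
count-+ {p = p} {q} {r} split = begin
  count p                                       ≡⟨ count≡∑ p ⟩
  sum (indicator ∘ p)                           ≡⟨ sum-cong-≗ split ⟩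
  sum (λ x → indicator (q x) + indicator (r x)) ≡⟨ ∑-distrib-+ (indicator ∘ q) (indicator ∘ r) ⟩
  sum (indicator ∘ q) + sum (indicator ∘ r)     ≡⟨ sym (cong₂ _+_ (count≡∑ q) (count≡∑ r)) ⟩
  count q + count r                             ∎
  where open ≡-Reasoning

∑-mono : ∀ {k} {f g : Fin k → ℕ} → (∀ x → f x ≤ g x) → sum f ≤ sum g
∑-mono {zero}  _   = z≤n
∑-mono {suc k} f≤g = +-mono-≤ (f≤g zero) (∑-mono (f≤g ∘ suc))

count-≤-+ : ∀ {k} {p q r : Fin k → Bool} →
  (∀ x → indicator (p x) ≤ indicator (q x) + indicator (r x)) → count p ≤ count q + count r
count-≤-+ {p = p} {q} {r} bound = begin
  count p                                       ≡⟨ count≡∑ p ⟩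
  sum (indicator ∘ p)                           ≤⟨ ∑-mono bound ⟩
  sum (λ x → indicator (q x) + indicator (r x)) ≡⟨ ∑-distrib-+ (indicator ∘ q) (indicator ∘ r) ⟩
  sum (indicator ∘ q) + sum (indicator ∘ r)     ≡⟨ sym (cong₂ _+_ (count≡∑ q) (count≡∑ r)) ⟩
  count q + count r                             ∎
  where open ≤-Reasoning

count-mono : ∀ {k} {p q : Fin k → Bool} → p ⊆ q → count p ≤ count q
count-mono {zero}  _ = z≤n
count-mono {suc k} p⊆q = +-mono-≤ (indicator-mono (p⊆q zero)) (count-mono (p⊆q ∘ suc))

count-strict : ∀ {k} {p q : Fin k → Bool} → p ⊆ q → ∀ x → p x ≡ false → q x ≡ true →
  count p < count q
count-strict {suc k} p⊆q zero    px qx = +-mono-<-≤ (indicator-< px qx) (count-mono (p⊆q ∘ suc))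
count-strict {suc k} p⊆q (suc x) px qx =
  +-mono-≤-< (indicator-mono (p⊆q zero)) (count-strict (p⊆q ∘ suc) x px qx)

count-false : ∀ {k} → count {k} (λ _ → false) ≡ 0
count-false {zero}  = refl
count-false {suc k} = count-false {k}

count-true : ∀ {k} → count {k} (λ _ → true) ≡ k
count-true {zero}  = refl
count-true {suc k} = cong suc (count-true {k})

count-⊆⇒⊇ : ∀ {k} {p q : Fin k → Bool} → p ⊆ q → count q ≤ count p → q ⊆ p
count-⊆⇒⊇ {p = p} p⊆q q≤p x qx with p x in px
... | true  = refl
... | false = ⊥-elim (<⇒≱ (count-strict p⊆q x px qx) q≤p)

count<size⇒missing : ∀ {k} (p : Fin k → Bool) → count p < k → ∃ λ x → p x ≡ false
count<size⇒missing {suc k} p count<k with p zero in p0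
... | false = zero , p0
... | true  with count<size⇒missing (p ∘ suc) (≤-pred count<k)
...   | x , px = suc x , px

count-split : ∀ {k} (p q : Fin k → Bool) →
  count p ≡ count (λ x → p x ∧ q x) + count (λ x → p x ∧ not (q x))
count-split p q = count-+ (λ x → indicator-split (p x) (q x))

count-const-∧ : ∀ {k} b (p : Fin k → Bool) → count (λ x → b ∧ p x) ≡ (if b then count p else 0)
count-const-∧ true  p = refl
count-const-∧ {k} false p = count-false {k}

∑-singleton : ∀ {k} (x : Fin k) (c : ℕ) → sum (λ v → if v ≡ᵇ x then c else 0) ≡ c
∑-singleton {suc k} zero c = trans (cong (c +_) (sum-replicate-zero k)) (+-identityʳ c)
∑-singleton {suc k} (suc x) c = ∑-singleton x c

count-singleton : ∀ {k} (x : Fin k) → count (_≡ᵇ x) ≡ 1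
count-singleton x = trans (count≡∑ (_≡ᵇ x)) (∑-singleton x 1)

count-all-but : ∀ {k} (x : Fin k) → suc (count (λ v → not (v ≡ᵇ x))) ≡ k
count-all-but {k} x = begin
  suc others                  ≡⟨ cong (_+ others) (count-singleton x) ⟨
  count (_≡ᵇ x) + others      ≡⟨ count-split {k} (λ _ → true) (_≡ᵇ x) ⟨
  count {k} (λ _ → true)      ≡⟨ count-true {k} ⟩
  k                           ∎
  where
  open ≡-Reasoning
  others = count (λ v → not (v ≡ᵇ x))

count-∧-singleton : ∀ {k} (p : Fin k → Bool) x → count (λ v → p v ∧ (v ≡ᵇ x)) ≡ indicator (p x)
count-∧-singleton p x = begin
  count (λ v → p v ∧ (v ≡ᵇ x))        ≡⟨ count-cong at-x ⟩
  count (λ v → p x ∧ (v ≡ᵇ x))        ≡⟨ count-const-∧ (p x) (_≡ᵇ x) ⟩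
  (if p x then count (_≡ᵇ x) else 0) ≡⟨ cong (λ c → if p x then c else 0) (count-singleton x) ⟩
  indicator (p x)                     ∎
  where
  open ≡-Reasoning
  at-x : ∀ v → p v ∧ (v ≡ᵇ x) ≡ p x ∧ (v ≡ᵇ x)
  at-x v with v ≟ x
  ... | yes refl = refl
  ... | no  _    = trans (∧-zeroʳ (p v)) (sym (∧-zeroʳ (p x)))

-- Parity

odd : ℕ → Bool
odd zero    = false
odd (suc n) = not (odd n)

odd-+ : ∀ m n → odd (m + n) ≡ odd m xor odd n
odd-+ zero    n = refl
odd-+ (suc m) n = trans (cong not (odd-+ m n)) (not-distribˡ-xor (odd m) (odd n))

odd-2* : ∀ m → odd (2 * m) ≡ false
odd-2* m = trans (odd-+ m (m + 0)) (trans (cong (λ k → odd m xor odd k) (+-identityʳ m)) (xor-same (odd m)))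

odd-indicator : ∀ b → odd (indicator b) ≡ b
odd-indicator true  = refl
odd-indicator false = refl

xor-interchange : ∀ a b c d → (a xor b) xor (c xor d) ≡ (a xor c) xor (b xor d)
xor-interchange false b false d = refl
xor-interchange false b true  d = sym (not-distribʳ-xor b d)
xor-interchange true  b false d = sym (not-distribˡ-xor b d)
xor-interchange true  b true  d = xor-annihilates-not b d

xor-cancelʳ : ∀ a b c → a xor c ≡ b xor c → a ≡ b
xor-cancelʳ false false _ _ = refl
xor-cancelʳ true  true  _ _ = refl
xor-cancelʳ false true  _ e = ⊥-elim (not-¬ refl e)
xor-cancelʳ true  false _ e = ⊥-elim (not-¬ refl (sym e))

odd-count-xor : ∀ {k} (p q : Fin k → Bool) →
  odd (count (λ x → p x xor q x)) ≡ odd (count p) xor odd (count q)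
odd-count-xor {zero}  p q = refl
odd-count-xor {suc k} p q = begin
  odd (indicator (p zero xor q zero) + count (λ x → p (suc x) xor q (suc x)))
    ≡⟨ odd-+ (indicator (p zero xor q zero)) _ ⟩
  odd (indicator (p zero xor q zero)) xor odd (count (λ x → p (suc x) xor q (suc x)))
    ≡⟨ cong₂ _xor_ (odd-indicator (p zero xor q zero)) (odd-count-xor (p ∘ suc) (q ∘ suc)) ⟩
  (p zero xor q zero) xor (odd (count (p ∘ suc)) xor odd (count (q ∘ suc)))
    ≡⟨ xor-interchange (p zero) (q zero) _ _ ⟩
  (p zero xor odd (count (p ∘ suc))) xor (q zero xor odd (count (q ∘ suc)))
    ≡⟨ sym (cong₂ _xor_ (odd-head p) (odd-head q)) ⟩
  odd (count p) xor odd (count q) ∎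
  where
  open ≡-Reasoning
  odd-head : (p : Fin (suc k) → Bool) → odd (count p) ≡ p zero xor odd (count (p ∘ suc))
  odd-head p = trans (odd-+ (indicator (p zero)) (count (p ∘ suc)))
                     (cong (_xor odd (count (p ∘ suc))) (odd-indicator (p zero)))

odd-count-const-∧ : ∀ {k} b (p : Fin k → Bool) → odd (count (λ x → b ∧ p x)) ≡ b ∧ odd (count p)
odd-count-const-∧ true  p = refl
odd-count-const-∧ {k} false p = cong odd (count-false {k})

odd-∑ : ∀ {k} (f : Fin k → ℕ) → odd (sum f) ≡ odd (count (odd ∘ f))
odd-∑ {zero}  f = refl
odd-∑ {suc k} f = begin
  odd (f zero + sum (f ∘ suc))
    ≡⟨ odd-+ (f zero) _ ⟩
  odd (f zero) xor odd (sum (f ∘ suc))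
    ≡⟨ cong₂ _xor_ (sym (odd-indicator (odd (f zero)))) (odd-∑ (f ∘ suc)) ⟩
  odd (indicator (odd (f zero))) xor odd (count (odd ∘ f ∘ suc))
    ≡⟨ sym (odd-+ (indicator (odd (f zero))) _) ⟩
  odd (count (odd ∘ f)) ∎
  where open ≡-Reasoning

odd-count-agree : ∀ {k} {p q : Fin k → Bool} r → (∀ v → v ≢ r → p v ≡ q v) →
  odd (count p) ≡ odd (count q) → p r ≡ q r
odd-count-agree {k} {p} {q} r agree same = xor-cancelʳ (p r) (q r) _ (begin
  p r xor odd (count (away p))  ≡⟨ sym (odd-split p) ⟩
  odd (count p)                 ≡⟨ same ⟩
  odd (count q)                 ≡⟨ odd-split q ⟩
  q r xor odd (count (away q))  ≡⟨ cong (λ k → q r xor odd k) (count-cong away-agree) ⟨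
  q r xor odd (count (away p))  ∎)
  where
  open ≡-Reasoning
  at away : (Fin k → Bool) → Fin k → Bool
  at   f v = f v ∧ (v ≡ᵇ r)
  away f v = f v ∧ not (v ≡ᵇ r)
  odd-split : ∀ f → odd (count f) ≡ f r xor odd (count (away f))
  odd-split f = begin
    odd (count f)                                   ≡⟨ cong odd (count-split f (_≡ᵇ r)) ⟩
    odd (count (at f) + count (away f))             ≡⟨ odd-+ (count (at f)) (count (away f)) ⟩
    odd (count (at f)) xor odd (count (away f))
      ≡⟨ cong (λ k → odd k xor odd (count (away f))) (count-∧-singleton f r) ⟩
    odd (indicator (f r)) xor odd (count (away f))
      ≡⟨ cong (_xor odd (count (away f))) (odd-indicator (f r)) ⟩
    f r xor odd (count (away f))                    ∎
  away-agree : ∀ v → away p v ≡ away q v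
  away-agree v with v ≟ r
  ... | yes refl = trans (∧-zeroʳ (p r)) (sym (∧-zeroʳ (q r)))
  ... | no  v≢r  = cong (_∧ true) (agree v v≢r)

-- Counting edges

degAbove : ∀ {n} → Adj n → Fin n → ℕ
degAbove r i = count (λ j → (toℕ i <ᵇ toℕ j) ∧ r i j)

-- Defs.pairCount sums its rows with a where-bound recursion that cannot be named here.
-- Generalising the outer size and the relation by `with` makes its unfolding a pattern
-- equation, so the metavariable `rowSum` is solved as that function.
pairCount≡∑ : ∀ {n} (r : Adj n) → pairCount r ≡ sum (degAbove r)
pairCount≡∑ = go
  where
  sum-unique : (s : ∀ {k} → (Fin k → ℕ) → ℕ) → (∀ (f : Fin 0 → ℕ) → s f ≡ 0) →
    (∀ {k} (f : Fin (suc k) → ℕ) → s f ≡ f zero + s (f ∘ suc)) →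
    ∀ {k} (f : Fin k → ℕ) → s f ≡ sum f
  sum-unique s s-zero s-suc {zero}  f = s-zero f
  sum-unique s s-zero s-suc {suc k} f =
    trans (s-suc f) (cong (f zero +_) (sum-unique s s-zero s-suc (f ∘ suc)))
  rowSum : ∀ {N} → Adj N → ∀ {k} → (Fin k → ℕ) → ℕ
  rowSum = _
  unfold : ∀ {m} (r : Adj (suc m)) → _ ≡ rowSum r (degAbove r ∘ suc)
  go : ∀ {n} (r : Adj n) → pairCount r ≡ sum (degAbove r)
  go {zero}  r = refl
  go {suc n} r = cong (degAbove r zero +_)
    (trans (unfold r) (sum-unique (rowSum r) (λ _ → refl) (λ _ → refl) (degAbove r ∘ suc)))
  unfold {m} r with degAbove r ∘ suc
  ... | _ with suc m | r
  ...   | _ | _ = refl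

pairCount-≤-+ : ∀ {n} {r s t : Adj n} →
  (∀ i j → indicator (r i j) ≤ indicator (s i j) + indicator (t i j)) →
  pairCount r ≤ pairCount s + pairCount t
pairCount-≤-+ {r = r} {s} {t} bound = begin
  pairCount r                                ≡⟨ pairCount≡∑ r ⟩
  sum (degAbove r)
    ≤⟨ ∑-mono (λ i → count-≤-+ (λ j → above (toℕ i <ᵇ toℕ j) (bound i j))) ⟩
  sum (λ i → degAbove s i + degAbove t i)    ≡⟨ ∑-distrib-+ (degAbove s) (degAbove t) ⟩
  sum (degAbove s) + sum (degAbove t)        ≡⟨ sym (cong₂ _+_ (pairCount≡∑ s) (pairCount≡∑ t)) ⟩
  pairCount s + pairCount t                  ∎
  where
  open ≤-Reasoning
  above : ∀ l {a b c} → indicator a ≤ indicator b + indicator c →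
    indicator (l ∧ a) ≤ indicator (l ∧ b) + indicator (l ∧ c)
  above true  a≤b+c = a≤b+c
  above false _     = z≤n

pairCount-+ : ∀ {n} {r s t : Adj n} →
  (∀ i j → indicator (r i j) ≡ indicator (s i j) + indicator (t i j)) →
  pairCount r ≡ pairCount s + pairCount t
pairCount-+ {r = r} {s} {t} split = begin
  pairCount r                                ≡⟨ pairCount≡∑ r ⟩
  sum (degAbove r)
    ≡⟨ sum-cong-≗ (λ i → count-+ (λ j → above (toℕ i <ᵇ toℕ j) (split i j))) ⟩
  sum (λ i → degAbove s i + degAbove t i)    ≡⟨ ∑-distrib-+ (degAbove s) (degAbove t) ⟩
  sum (degAbove s) + sum (degAbove t)        ≡⟨ sym (cong₂ _+_ (pairCount≡∑ s) (pairCount≡∑ t)) ⟩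
  pairCount s + pairCount t                  ∎
  where
  open ≡-Reasoning
  above : ∀ l {a b c} → indicator a ≡ indicator b + indicator c →
    indicator (l ∧ a) ≡ indicator (l ∧ b) + indicator (l ∧ c)
  above true  a≡b+c = a≡b+c
  above false _     = refl

pairCount-mono : ∀ {n} {r s : Adj n} → r ⇒ s → pairCount r ≤ pairCount s
pairCount-mono {r = r} {s} r⇒s = begin
  pairCount r       ≡⟨ pairCount≡∑ r ⟩
  sum (degAbove r)  ≤⟨ ∑-mono (λ i → count-mono (λ j → above (toℕ i <ᵇ toℕ j) (r⇒s i j))) ⟩
  sum (degAbove s)  ≡⟨ pairCount≡∑ s ⟨
  pairCount s       ∎
  where
  open ≤-Reasoning
  above : ∀ l {a b} → (a ≡ true → b ≡ true) → l ∧ a ≡ true → l ∧ b ≡ true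
  above true a⇒b = a⇒b

pairCount-cong : ∀ {n} {r s : Adj n} → (∀ i j → r i j ≡ s i j) → pairCount r ≡ pairCount s
pairCount-cong {r = r} {s} r≗s = begin
  pairCount r       ≡⟨ pairCount≡∑ r ⟩
  sum (degAbove r)  ≡⟨ sum-cong-≗ (λ i → count-cong (λ j → cong ((toℕ i <ᵇ toℕ j) ∧_) (r≗s i j))) ⟩
  sum (degAbove s)  ≡⟨ pairCount≡∑ s ⟨
  pairCount s       ∎
  where open ≡-Reasoning

pairCount-empty : ∀ {n} {r : Adj n} → (∀ i j → r i j ≡ false) → pairCount r ≡ 0
pairCount-empty {n} {r} r≡false = begin
  pairCount r        ≡⟨ pairCount≡∑ r ⟩
  sum (degAbove r)   ≡⟨ sum-cong-≗ empty-row ⟩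
  sum {n} (λ _ → 0)  ≡⟨ sum-replicate-zero n ⟩
  0                  ∎
  where
  open ≡-Reasoning
  empty-row : ∀ i → degAbove r i ≡ 0
  empty-row i = trans (count-cong (λ j → trans (cong ((toℕ i <ᵇ toℕ j) ∧_) (r≡false i j)) (∧-zeroʳ _)))
                      (count-false {n})

pairCount-∨ : ∀ {n} (r s : Adj n) → pairCount (λ i j → r i j ∨ s i j) ≤ pairCount r + pairCount s
pairCount-∨ r s = pairCount-≤-+ (λ i j → indicator-∨ (r i j) (s i j))
  where
  indicator-∨ : ∀ a b → indicator (a ∨ b) ≤ indicator a + indicator b
  indicator-∨ true  _ = s≤s z≤n
  indicator-∨ false _ = ≤-refl

pairCount-split : ∀ {n} (r q : Adj n) →
  pairCount r ≡ pairCount (λ i j → r i j ∧ q i j) + pairCount (λ i j → r i j ∧ not (q i j))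
pairCount-split r q = pairCount-+ (λ i j → indicator-split (r i j) (q i j))

∑-count-transpose : ∀ {m n} (F : Fin m → Fin n → Bool) →
  sum (λ i → count (λ j → F i j)) ≡ sum (λ j → count (λ i → F i j))
∑-count-transpose F = begin
  sum (λ i → count (λ j → F i j))               ≡⟨ sum-cong-≗ (λ i → count≡∑ (F i)) ⟩
  sum (λ i → sum (λ j → indicator (F i j)))     ≡⟨ ∑-comm (λ i j → indicator (F i j)) ⟩
  sum (λ j → sum (λ i → indicator (F i j)))     ≡⟨ sum-cong-≗ (λ j → count≡∑ (λ i → F i j)) ⟨
  sum (λ j → count (λ i → F i j))               ∎
  where open ≡-Reasoning

<ᵇ-true : ∀ {m n} → m < n → (m <ᵇ n) ≡ true
<ᵇ-true {m} {n} = dec-true (m <? n)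

<ᵇ-false : ∀ {m n} → ¬ m < n → (m <ᵇ n) ≡ false
<ᵇ-false {m} {n} = dec-false (m <? n)

handshake : ∀ {n} {r : Adj n} → Symmetric r → Irreflexive r → sum (degA r) ≡ 2 * pairCount r
handshake {n} {r} r-sym r-irr = begin
  sum (degA r)
    ≡⟨ sum-cong-≗ (λ i → count-split (r i) (λ j → toℕ i <ᵇ toℕ j)) ⟩
  sum (λ i → count (λ j → r i j ∧ (toℕ i <ᵇ toℕ j)) + count (λ j → r i j ∧ not (toℕ i <ᵇ toℕ j)))
    ≡⟨ ∑-distrib-+ (λ i → count (λ j → r i j ∧ (toℕ i <ᵇ toℕ j))) _ ⟩
  sum (λ i → count (λ j → r i j ∧ (toℕ i <ᵇ toℕ j)))
    + sum (λ i → count (λ j → r i j ∧ not (toℕ i <ᵇ toℕ j)))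
    ≡⟨ cong₂ _+_ (sum-cong-≗ (λ i → count-cong (λ j → ∧-comm (r i j) _)))
                 (sum-cong-≗ (λ i → count-cong (λ j → below≡transposed-above i j))) ⟩
  sum (degAbove r) + sum (λ i → count (λ j → (toℕ j <ᵇ toℕ i) ∧ r j i))
    ≡⟨ cong (sum (degAbove r) +_) (∑-count-transpose (λ i j → (toℕ j <ᵇ toℕ i) ∧ r j i)) ⟩
  sum (degAbove r) + sum (degAbove r)
    ≡⟨ cong (λ a → a + a) (pairCount≡∑ r) ⟨
  pairCount r + pairCount r
    ≡⟨ cong (pairCount r +_) (+-identityʳ (pairCount r)) ⟨
  2 * pairCount r ∎
  where
  open ≡-Reasoning
  below≡transposed-above : ∀ i j → r i j ∧ not (toℕ i <ᵇ toℕ j) ≡ (toℕ j <ᵇ toℕ i) ∧ r j i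
  below≡transposed-above i j with <-cmp (toℕ i) (toℕ j)
  ... | tri< i<j _ j≮i rewrite <ᵇ-true i<j | <ᵇ-false j≮i = ∧-zeroʳ (r i j)
  ... | tri≈ _ i≡j _   rewrite toℕ-injective i≡j | r-irr j = sym (∧-zeroʳ _)
  ... | tri> i≮j _ j<i rewrite <ᵇ-false i≮j | <ᵇ-true j<i = trans (∧-identityʳ (r i j)) (r-sym i j)

handshake-parity : ∀ {n} {r : Adj n} → Symmetric r → Irreflexive r →
  odd (count (λ v → odd (degA r v))) ≡ false
handshake-parity {r = r} r-sym r-irr =
  trans (sym (odd-∑ (degA r))) (trans (cong odd (handshake r-sym r-irr)) (odd-2* (pairCount r)))

crossing : ∀ {n} → (Fin n → Bool) → Adj n → Adj n
crossing R r i j = r i j ∧ (R i xor R j)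

star : ∀ {n} → Fin n → Adj n → Adj n
star x = crossing (_≡ᵇ x)

crossing-symmetric : ∀ {n} (R : Fin n → Bool) {r : Adj n} → Symmetric r → Symmetric (crossing R r)
crossing-symmetric R r-sym i j = cong₂ _∧_ (r-sym i j) (xor-comm (R i) (R j))

crossing-irreflexive : ∀ {n} (R : Fin n → Bool) (r : Adj n) → Irreflexive (crossing R r)
crossing-irreflexive R r i = trans (cong (r i i ∧_) (xor-same (R i))) (∧-zeroʳ (r i i))

degA-star : ∀ {n} {r : Adj n} → Irreflexive r → ∀ x v →
  degA (star x r) v ≡ (if v ≡ᵇ x then degA r x else 0) + indicator (r v x)
degA-star {r = r} r-irr x v with v ≟ x
... | no  _    = count-∧-singleton (r v) x
... | yes refl = begin
  count (λ j → r x j ∧ not (j ≡ᵇ x)) ≡⟨ count-cong away-from-x ⟩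
  degA r x                           ≡⟨ +-identityʳ (degA r x) ⟨
  degA r x + 0                       ≡⟨ cong (λ b → degA r x + indicator b) (r-irr x) ⟨
  degA r x + indicator (r x x)       ∎
  where
  open ≡-Reasoning
  away-from-x : ∀ j → r x j ∧ not (j ≡ᵇ x) ≡ r x j
  away-from-x j with j ≟ x
  ... | yes refl = trans (∧-zeroʳ (r x x)) (sym (r-irr x))
  ... | no  _    = ∧-identityʳ (r x j)

pairCount-star : ∀ {n} {r : Adj n} → Symmetric r → Irreflexive r → ∀ x → pairCount (star x r) ≡ degA r x
pairCount-star {r = r} r-sym r-irr x = *-cancelˡ-≡ _ _ 2 (begin
  2 * pairCount (star x r)
    ≡⟨ handshake (crossing-symmetric (_≡ᵇ x) r-sym) (crossing-irreflexive (_≡ᵇ x) r) ⟨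
  sum (degA (star x r))
    ≡⟨ sum-cong-≗ (degA-star r-irr x) ⟩
  sum (λ v → (if v ≡ᵇ x then degA r x else 0) + indicator (r v x))
    ≡⟨ ∑-distrib-+ (λ v → if v ≡ᵇ x then degA r x else 0) (λ v → indicator (r v x)) ⟩
  sum (λ v → if v ≡ᵇ x then degA r x else 0) + sum (λ v → indicator (r v x))
    ≡⟨ cong₂ _+_ (∑-singleton x (degA r x)) (sym (count≡∑ (λ v → r v x))) ⟩
  degA r x + count (λ v → r v x)
    ≡⟨ cong (degA r x +_) (trans (count-cong (λ v → r-sym v x)) (sym (+-identityʳ (degA r x)))) ⟩
  2 * degA r x ∎)
  where open ≡-Reasoning

edge : ∀ {n} → Fin n → Fin n → Adj n
edge x p i j = (i ≡ᵇ x ∧ j ≡ᵇ p) ∨ (i ≡ᵇ p ∧ j ≡ᵇ x)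

edge-symmetric : ∀ {n} (x p : Fin n) → Symmetric (edge x p)
edge-symmetric x p i j = trans (∨-comm (i ≡ᵇ x ∧ j ≡ᵇ p) _)
                               (cong₂ _∨_ (∧-comm (i ≡ᵇ p) (j ≡ᵇ x)) (∧-comm (i ≡ᵇ x) (j ≡ᵇ p)))

edge-irreflexive : ∀ {n} {x p : Fin n} → x ≢ p → Irreflexive (edge x p)
edge-irreflexive {x = x} {p} x≢p i with i ≟ x | i ≟ p
... | yes refl | yes refl = ⊥-elim (x≢p refl)
... | yes refl | no  _    = refl
... | no  _    | yes refl = refl
... | no  _    | no  _    = refl

edge-endpoints : ∀ {n} (x p i j : Fin n) → edge x p i j ≡ true → (i ≡ x × j ≡ p) ⊎ (i ≡ p × j ≡ x)
edge-endpoints x p i j e with i ≟ x | j ≟ p | i ≟ p | j ≟ x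
... | yes i≡x | yes j≡p | _       | _       = inj₁ (i≡x , j≡p)
... | _       | _       | yes i≡p | yes j≡x = inj₂ (i≡p , j≡x)
... | yes _   | no  _   | yes _   | no  _   = ⊥-elim (true≢false (sym e))
... | yes _   | no  _   | no  _   | _       = ⊥-elim (true≢false (sym e))
... | no  _   | _       | yes _   | no  _   = ⊥-elim (true≢false (sym e))
... | no  _   | _       | no  _   | _       = ⊥-elim (true≢false (sym e))

degA-edge : ∀ {n} {x p : Fin n} → x ≢ p → ∀ v →
  degA (edge x p) v ≡ indicator (v ≡ᵇ x) + indicator (v ≡ᵇ p)
degA-edge {n} {x} {p} x≢p v with v ≟ x | v ≟ p
... | yes refl | yes refl = ⊥-elim (x≢p refl)
... | yes refl | no  _    = trans (count-cong (λ j → ∨-identityʳ (j ≡ᵇ p))) (count-singleton p)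
... | no  _    | yes refl = count-singleton x
... | no  _    | no  _    = count-false {n}

odd-degA-edge : ∀ {n} {x p : Fin n} → x ≢ p → ∀ v → odd (degA (edge x p) v) ≡ (v ≡ᵇ x) xor (v ≡ᵇ p)
odd-degA-edge {x = x} {p} x≢p v = trans (cong odd (degA-edge x≢p v))
  (trans (odd-+ (indicator (v ≡ᵇ x)) (indicator (v ≡ᵇ p)))
         (cong₂ _xor_ (odd-indicator (v ≡ᵇ x)) (odd-indicator (v ≡ᵇ p))))

pairCount-edge : ∀ {n} {x p : Fin n} → x ≢ p → pairCount (edge x p) ≡ 1
pairCount-edge {x = x} {p} x≢p = *-cancelˡ-≡ _ _ 2 (begin
  2 * pairCount (edge x p)
    ≡⟨ handshake (edge-symmetric x p) (edge-irreflexive x≢p) ⟨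
  sum (degA (edge x p))
    ≡⟨ sum-cong-≗ (degA-edge x≢p) ⟩
  sum (λ v → indicator (v ≡ᵇ x) + indicator (v ≡ᵇ p))
    ≡⟨ ∑-distrib-+ (indicator ∘ (_≡ᵇ x)) (indicator ∘ (_≡ᵇ p)) ⟩
  sum (indicator ∘ (_≡ᵇ x)) + sum (indicator ∘ (_≡ᵇ p))
    ≡⟨ cong₂ _+_ (∑-singleton x 1) (∑-singleton p 1) ⟩
  2 ∎)
  where open ≡-Reasoning

pairCount-pos : ∀ {n} {r : Adj n} → Symmetric r → Irreflexive r → ∀ i j → r i j ≡ true → 0 < pairCount r
pairCount-pos {r = r} r-sym r-irr i j rij = begin
  1                     ≡⟨ pairCount-edge i≢j ⟨
  pairCount (edge i j)  ≤⟨ pairCount-mono edge⇒r ⟩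
  pairCount r           ∎
  where
  open ≤-Reasoning
  i≢j : i ≢ j
  i≢j refl = true≢false (trans (sym rij) (r-irr i))
  edge⇒r : edge i j ⇒ r
  edge⇒r a b e with edge-endpoints i j a b e
  ... | inj₁ (refl , refl) = rij
  ... | inj₂ (refl , refl) = trans (r-sym a b) rij

-- Parity joins in subtrees

insert : ∀ {n} → Fin n → (Fin n → Bool) → Fin n → Bool
insert x R v = R v ∨ (v ≡ᵇ x)

count-insert : ∀ {n} {R : Fin n → Bool} {x} → R x ≡ false → count (insert x R) ≡ suc (count R)
count-insert {R = R} {x} Rx = trans (count-+ split) (cong (_+ count R) (count-singleton x))
  where
  split : ∀ v → indicator (insert x R v) ≡ indicator (v ≡ᵇ x) + indicator (R v)
  split v with v ≟ x
  ... | yes refl rewrite Rx = refl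
  ... | no  _    = cong indicator (∨-identityʳ (R v))

-- R is the vertex set of a subtree of H containing r₀, grown one leaf at a time.
data Spanned {n} (H : Adj n) (r₀ : Fin n) : (Fin n → Bool) → Set where
  root : Spanned H r₀ (_≡ᵇ r₀)
  leaf : ∀ {R p x} → Spanned H r₀ R → R p ≡ true → R x ≡ false → H p x ≡ true →
         Spanned H r₀ (insert x R)

spanned-root : ∀ {n} {H : Adj n} {r₀ R} → Spanned H r₀ R → R r₀ ≡ true
spanned-root {r₀ = r₀} root = dec-true (r₀ ≟ r₀) refl
spanned-root (leaf spanned _ _ _) rewrite spanned-root spanned = refl

record ParityJoin {n} (H : Adj n) (r₀ : Fin n) (R Y : Fin n → Bool) : Set where
  field
    edges     : Adj n
    symmetric : Symmetric edges
    ⇒H        : edges ⇒ H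
    inside    : ∀ i j → edges i j ≡ true → R i ≡ true
    small     : pairCount edges < count R
    parity    : ∀ v → R v ≡ true → v ≢ r₀ → odd (degA edges v) ≡ Y v

module _ {n} {H : Adj n} (H-sym : Symmetric H) {r₀ : Fin n} where

  emptyJoin : ∀ Y → ParityJoin H r₀ (_≡ᵇ r₀) Y
  emptyJoin Y = record
    { edges     = λ _ _ → false
    ; symmetric = λ _ _ → refl
    ; ⇒H        = λ _ _ ()
    ; inside    = λ _ _ ()
    ; small     = subst (pairCount {n} (λ _ _ → false) <_) (sym (count-singleton r₀))
                        (s≤s (≤-reflexive (pairCount-empty {n} {λ _ _ → false} (λ _ _ → refl))))
    ; parity    = λ v v≡r₀ v≢r₀ → ⊥-elim (v≢r₀ (≡ᵇ-sound v≡r₀))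
    }

  -- A new leaf x below p with odd demand takes the edge xp, which toggles the demand at p.
  module AddLeaf {R : Fin n → Bool} {p x : Fin n} (Rp : R p ≡ true) (Rx : R x ≡ false) (Hpx : H p x ≡ true)
                 (Y : Fin n → Bool) (old : ParityJoin H r₀ R (λ v → Y v xor (Y x ∧ (v ≡ᵇ p)))) where
    open ParityJoin old renaming (edges to J)

    x≢p : x ≢ p
    x≢p refl = true≢false (trans (sym Rp) Rx)

    J′ : Adj n
    J′ i j = J i j xor (Y x ∧ edge x p i j)

    J′⇒H : J′ ⇒ H
    J′⇒H i j e with xor-true⁻ e
    ... | inj₁ Jij = ⇒H i j Jij
    ... | inj₂ Eij with edge-endpoints x p i j (proj₂ (∧-true⁻ Eij))
    ...   | inj₁ (refl , refl) = trans (H-sym x p) Hpx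
    ...   | inj₂ (refl , refl) = Hpx

    J′-inside : ∀ i j → J′ i j ≡ true → insert x R i ≡ true
    J′-inside i j e with xor-true⁻ e
    ... | inj₁ Jij rewrite inside i j Jij = refl
    ... | inj₂ Eij with edge-endpoints x p i j (proj₂ (∧-true⁻ Eij))
    ...   | inj₁ (refl , refl) = trans (cong (R x ∨_) (dec-true (x ≟ x) refl)) (∨-zeroʳ (R x))
    ...   | inj₂ (refl , refl) rewrite Rp = refl

    J′-small : pairCount J′ < count (insert x R)
    J′-small = begin-strict
      pairCount J′
        ≤⟨ pairCount-≤-+ (λ i j → indicator-xor (J i j) _) ⟩
      pairCount J + pairCount (λ i j → Y x ∧ edge x p i j)
        ≤⟨ +-monoʳ-≤ (pairCount J) (pairCount-mono {s = edge x p} (λ i j e → proj₂ (∧-true⁻ {Y x} e))) ⟩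
      pairCount J + pairCount (edge x p)  ≡⟨ cong (pairCount J +_) (pairCount-edge x≢p) ⟩
      pairCount J + 1                     ≡⟨ +-comm (pairCount J) 1 ⟩
      suc (pairCount J)                   ≤⟨ small ⟩
      count R                             <⟨ n<1+n (count R) ⟩
      suc (count R)                       ≡⟨ count-insert {R = R} Rx ⟨
      count (insert x R)                  ∎
      where
      open ≤-Reasoning
      indicator-xor : ∀ a b → indicator (a xor b) ≤ indicator a + indicator b
      indicator-xor true  true  = z≤n
      indicator-xor true  false = ≤-refl
      indicator-xor false _     = ≤-refl

    J-avoids-x : degA J x ≡ 0
    J-avoids-x = trans (count-cong no-edge) (count-false {n})
      where
      no-edge : ∀ j → J x j ≡ false
      no-edge j with J x j in Jxj
      ... | false = refl
      ... | true  = ⊥-elim (true≢false (trans (sym (inside x j Jxj)) Rx))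

    odd-degA-J′ : ∀ v → odd (degA J′ v) ≡ odd (degA J v) xor (Y x ∧ ((v ≡ᵇ x) xor (v ≡ᵇ p)))
    odd-degA-J′ v = trans (odd-count-xor (J v) (λ j → Y x ∧ edge x p v j))
      (cong (odd (degA J v) xor_)
            (trans (odd-count-const-∧ (Y x) (edge x p v)) (cong (Y x ∧_) (odd-degA-edge x≢p v))))

    demand-met : ∀ v → insert x R v ≡ true → v ≢ r₀ →
      odd (degA J v) xor (Y x ∧ ((v ≡ᵇ x) xor (v ≡ᵇ p))) ≡ Y v
    demand-met v Rv v≢r₀ with v ≟ x
    ... | yes refl = begin
      odd (degA J x) xor (Y x ∧ not (x ≡ᵇ p))
        ≡⟨ cong₂ (λ d b → odd d xor (Y x ∧ not b)) J-avoids-x (dec-false (x ≟ p) x≢p) ⟩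
      Y x ∧ true
        ≡⟨ ∧-identityʳ (Y x) ⟩
      Y x ∎
      where open ≡-Reasoning
    ... | no  v≢x  = begin
      odd (degA J v) xor toggle    ≡⟨ cong (_xor toggle) (parity v (trans (sym (∨-identityʳ (R v))) Rv) v≢r₀) ⟩
      (Y v xor toggle) xor toggle  ≡⟨ xor-assoc (Y v) toggle toggle ⟩
      Y v xor (toggle xor toggle)  ≡⟨ cong (Y v xor_) (xor-same toggle) ⟩
      Y v xor false                ≡⟨ xor-identityʳ (Y v) ⟩
      Y v                          ∎
      where
      open ≡-Reasoning
      toggle = Y x ∧ (v ≡ᵇ p)

    extended : ParityJoin H r₀ (insert x R) Y
    extended = record
      { edges     = J′
      ; symmetric = λ i j → cong₂ _xor_ (symmetric i j) (cong (Y x ∧_) (edge-symmetric x p i j))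
      ; ⇒H        = J′⇒H
      ; inside    = J′-inside
      ; small     = J′-small
      ; parity    = λ v Rv v≢r₀ → trans (odd-degA-J′ v) (demand-met v Rv v≢r₀)
      }

  parityJoin : ∀ {R} → Spanned H r₀ R → ∀ Y → ParityJoin H r₀ R Y
  parityJoin root                       Y = emptyJoin Y
  parityJoin (leaf spanned Rp Rx Hpx) Y = AddLeaf.extended Rp Rx Hpx Y (parityJoin spanned _)

-- Irregular subgraphs

locallyIrregular-cong : ∀ {n} {r s : Adj n} → (∀ i j → r i j ≡ s i j) →
  LocallyIrregularA r → LocallyIrregularA s
locallyIrregular-cong r≗s r-irregular i j sij same = r-irregular i j (trans (r≗s i j) sij)
  (trans (count-cong (r≗s i)) (trans same (sym (count-cong (r≗s j)))))

locallyIrregular-byParity : ∀ {n} {K : Adj n} (t : Fin n → Bool) → (∀ v → odd (degA K v) ≡ t v) →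
  (∀ i j → K i j ≡ true → t i ≢ t j) → LocallyIrregularA K
locallyIrregular-byParity t odd≡t t-differs i j Kij same =
  t-differs i j Kij (trans (sym (odd≡t i)) (trans (cong odd same) (odd≡t j)))

ieAtMost-mono : ∀ {n} {G : Graph n} {k l} → k ≤ l → IeAtMost G k → IeAtMost G l
ieAtMost-mono k≤l (S , irregular , |S|≤k) = S , irregular , ≤-trans |S|≤k k≤l

ieAtMost-subgraph : ∀ {n} (G : Graph n) (K : Adj n) → K ⇒ adj G → Symmetric K → LocallyIrregularA K →
  IeAtMost G (pairCount (λ i j → adj G i j ∧ not (K i j)))
ieAtMost-subgraph G K K⇒G K-sym K-irregular = S , locallyIrregular-cong K≡G-S K-irregular , ≤-refl
  where
  S : EdgeSet G
  S = record
    { mem    = λ i j → adj G i j ∧ not (K i j)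
    ; memSym = λ i j → cong₂ (λ a k → a ∧ not k) (Graph.sym G i j) (K-sym i j)
    ; sub    = λ i j e → proj₁ (∧-true⁻ e)
    }
  K≡G-S : ∀ i j → K i j ≡ minusAdj G S i j
  K≡G-S i j with K i j in Kij
  ... | true  rewrite K⇒G i j Kij = refl
  ... | false with adj G i j
  ...   | true  = refl
  ...   | false = refl

-- Maximum cuts

≤-half : ∀ {k m} → 2 * k ≤ m → k ≤ m / 2
≤-half {k} {m} 2k≤m = subst (_≤ m / 2) (m*n/n≡m k 2) (/-monoˡ-≤ 2 (subst (_≤ m) (*-comm 2 k) 2k≤m))

maximiser : ∀ {n} (F : Vec Bool n → ℕ) → ∃ λ v → ∀ w → F w ≤ F v
maximiser {zero}  F = [] , λ { [] → ≤-refl }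
maximiser {suc n} F with maximiser (F ∘ (true ∷_)) | maximiser (F ∘ (false ∷_))
... | vt , vt-max | vf , vf-max with ≤-total (F (true ∷ vt)) (F (false ∷ vf))
...   | inj₁ t≤f = false ∷ vf , λ { (true ∷ w) → ≤-trans (vt-max w) t≤f ; (false ∷ w) → vf-max w }
...   | inj₂ f≤t = true ∷ vt  , λ { (true ∷ w) → vt-max w ; (false ∷ w) → ≤-trans (vf-max w) f≤t }

LeavingEdge : ∀ {n} → Adj n → (Fin n → Bool) → Set
LeavingEdge r R = ∃₂ λ p q → R p ≡ true × R q ≡ false × r p q ≡ true

leavingEdge? : ∀ {n} (r : Adj n) R → Dec (LeavingEdge r R)
leavingEdge? r R = any? (λ p → any? (λ q → (R p ≟ᵇ true) ×-dec ((R q ≟ᵇ false) ×-dec (r p q ≟ᵇ true))))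

no-leaving⇒no-crossing : ∀ {n} {r : Adj n} {R} → Symmetric r → ¬ LeavingEdge r R →
  ∀ i j → crossing R r i j ≡ false
no-leaving⇒no-crossing {r = r} {R} r-sym ¬leaving i j with R i in Ri | R j in Rj | r i j in rij
... | true  | false | true  = ⊥-elim (¬leaving (i , j , Ri , Rj , rij))
... | false | true  | true  = ⊥-elim (¬leaving (j , i , Rj , Ri , trans (r-sym j i) rij))
... | true  | true  | true  = refl
... | false | false | true  = refl
... | _     | _     | false = refl

walk-leaves : ∀ {n} {G : Graph n} {u w} → Walk G u w → ∀ R → R u ≡ true → R w ≡ false →
  LeavingEdge (adj G) R
walk-leaves here                 R Ru Rw = ⊥-elim (true≢false (trans (sym Ru) Rw))
walk-leaves (step {v = v} e rest) R Ru Rw with R v in Rv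
... | true  = walk-leaves rest R Rv Rw
... | false = _ , v , Ru , Rv , e

module MaxCut {n} (G : Graph n) where

  cut : (Fin n → Bool) → Adj n
  cut c = crossing c (adj G)

  uncut : (Fin n → Bool) → Adj n
  uncut c i j = adj G i j ∧ not (c i xor c j)

  cut-symmetric : ∀ c → Symmetric (cut c)
  cut-symmetric c = crossing-symmetric c (Graph.sym G)

  uncut-symmetric : ∀ c → Symmetric (uncut c)
  uncut-symmetric c i j = cong₂ (λ a x → a ∧ not x) (Graph.sym G i j) (xor-comm (c i) (c j))

  uncut-irreflexive : ∀ c → Irreflexive (uncut c)
  uncut-irreflexive c i rewrite irrefl G i = refl

  opaque
    side : Fin n → Bool
    side = lookup (proj₁ (maximiser (pairCount ∘ cut ∘ lookup)))

    side-maximal : ∀ c → pairCount (cut c) ≤ pairCount (cut side)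
    side-maximal c = subst (_≤ pairCount (cut side)) (pairCount-cong relabel)
                           (proj₂ (maximiser (pairCount ∘ cut ∘ lookup)) (tabulate c))
      where
      relabel : ∀ i j → cut (lookup (tabulate c)) i j ≡ cut c i j
      relabel i j = cong₂ (λ a b → adj G i j ∧ (a xor b)) (lookup∘tabulate c i) (lookup∘tabulate c j)

  -- Flipping the sides of all vertices of R turns the cut edges crossing R into uncut ones and back.
  crossing-uncut≤crossing-cut : ∀ R →
    pairCount (crossing R (uncut side)) ≤ pairCount (crossing R (cut side))
  crossing-uncut≤crossing-cut R = +-cancelʳ-≤ (pairCount kept) _ _ (begin
    pairCount (crossing R (uncut side)) + pairCount kept
      ≡⟨ cong₂ _+_ (pairCount-cong turned) (pairCount-cong stays) ⟨
    pairCount (crossing R (cut flipped)) + pairCount (λ i j → cut flipped i j ∧ not (R i xor R j))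
      ≡⟨ pairCount-split (cut flipped) (λ i j → R i xor R j) ⟨
    pairCount (cut flipped)
      ≤⟨ side-maximal flipped ⟩
    pairCount (cut side)
      ≡⟨ pairCount-split (cut side) (λ i j → R i xor R j) ⟩
    pairCount (crossing R (cut side)) + pairCount kept ∎)
    where
    open ≤-Reasoning
    flipped : Fin n → Bool
    flipped v = side v xor R v
    kept : Adj n
    kept i j = cut side i j ∧ not (R i xor R j)
    flipped-xor : ∀ i j → flipped i xor flipped j ≡ (side i xor side j) xor (R i xor R j)
    flipped-xor i j = xor-interchange (side i) (R i) (side j) (R j)
    turned : ∀ i j → crossing R (cut flipped) i j ≡ crossing R (uncut side) i j
    turned i j = trans (cong (λ x → (adj G i j ∧ x) ∧ (R i xor R j)) (flipped-xor i j))
                       (toggled (adj G i j) (side i xor side j) (R i xor R j))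
      where
      toggled : ∀ a x c → (a ∧ (x xor c)) ∧ c ≡ (a ∧ not x) ∧ c
      toggled a x true  = cong (λ y → (a ∧ y) ∧ true) (xor-comm x true)
      toggled a x false = trans (∧-zeroʳ _) (sym (∧-zeroʳ _))
    stays : ∀ i j → cut flipped i j ∧ not (R i xor R j) ≡ kept i j
    stays i j = trans (cong (λ x → (adj G i j ∧ x) ∧ not (R i xor R j)) (flipped-xor i j))
                      (untoggled (adj G i j) (side i xor side j) (R i xor R j))
      where
      untoggled : ∀ a x c → (a ∧ (x xor c)) ∧ not c ≡ (a ∧ x) ∧ not c
      untoggled a x true  = trans (∧-zeroʳ _) (sym (∧-zeroʳ _))
      untoggled a x false = cong (λ y → (a ∧ y) ∧ true) (xor-identityʳ x)

  uncut-degree≤cut-degree : ∀ v → degA (uncut side) v ≤ degA (cut side) v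
  uncut-degree≤cut-degree v = subst₂ _≤_
    (pairCount-star (uncut-symmetric side) (uncut-irreflexive side) v)
    (pairCount-star (cut-symmetric side) (crossing-irreflexive side (adj G)) v)
    (crossing-uncut≤crossing-cut (_≡ᵇ v))

  uncut≤half : pairCount (uncut side) ≤ size G / 2
  uncut≤half = ≤-half (begin
    2 * pairCount (uncut side)                       ≡⟨ cong (pairCount (uncut side) +_) (+-identityʳ _) ⟩
    pairCount (uncut side) + pairCount (uncut side)  ≤⟨ +-monoʳ-≤ (pairCount (uncut side)) uncut≤cut ⟩
    pairCount (uncut side) + pairCount (cut side)    ≡⟨ +-comm (pairCount (uncut side)) _ ⟩
    pairCount (cut side) + pairCount (uncut side)    ≡⟨ pairCount-split (adj G) (λ i j → side i xor side j) ⟨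
    size G                                           ∎)
    where
    open ≤-Reasoning
    uncut≤cut : pairCount (uncut side) ≤ pairCount (cut side)
    uncut≤cut = *-cancelˡ-≤ 2 (subst₂ _≤_
      (handshake (uncut-symmetric side) (uncut-irreflexive side))
      (handshake (cut-symmetric side) (crossing-irreflexive side (adj G)))
      (∑-mono uncut-degree≤cut-degree))

  cut-leaving : ∀ {R} → LeavingEdge (adj G) R → LeavingEdge (cut side) R
  cut-leaving {R} (p , q , Rp , Rq , Gpq) with leavingEdge? (cut side) R
  ... | yes leaving = leaving
  ... | no ¬leaving with side p xor side q in Xpq
  ...   | true  = ⊥-elim (¬leaving (p , q , Rp , Rq , cong₂ _∧_ Gpq Xpq))
  ...   | false = ⊥-elim (<-irrefl refl (begin-strict
    0
      <⟨ pairCount-pos (crossing-symmetric R (uncut-symmetric side)) (crossing-irreflexive R (uncut side))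
                       p q uncut-crossing ⟩
    pairCount (crossing R (uncut side))
      ≤⟨ crossing-uncut≤crossing-cut R ⟩
    pairCount (crossing R (cut side))
      ≡⟨ pairCount-empty (no-leaving⇒no-crossing (cut-symmetric side) ¬leaving) ⟩
    0 ∎))
    where
    open ≤-Reasoning
    uncut-crossing : crossing R (uncut side) p q ≡ true
    uncut-crossing rewrite Gpq | Xpq | Rp | Rq = refl

  spanned-of-size : Connected G → ∀ r₀ k → k < n → ∃ λ R → Spanned (cut side) r₀ R × count R ≡ suc k
  spanned-of-size connected r₀ zero    _   = _≡ᵇ r₀ , root , count-singleton r₀
  spanned-of-size connected r₀ (suc k) k<n with spanned-of-size connected r₀ k (≤-trans (n≤1+n _) k<n)
  ... | R , spanned , |R| with count<size⇒missing R (subst (_< n) (sym |R|) k<n)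
  ...   | w , Rw with cut-leaving (walk-leaves (connected r₀ w) R (spanned-root spanned) Rw)
  ...     | p , x , Rp , Rx , Hpx =
    insert x R , leaf spanned Rp Rx Hpx , trans (count-insert {R = R} Rx) (cong suc |R|)

  outside : (Fin n → Bool) → Adj n
  outside R i j = adj G i j ∧ not (R i ∧ R j)

  module Subtree {r₀ : Fin n} {R : Fin n → Bool} (spanned : Spanned (cut side) r₀ R) (b : Bool)
                 (even : odd (count (λ v → R v ∧ (side v xor b))) ≡ false) where
    target : Fin n → Bool
    target v = R v ∧ (side v xor b)

    inner : Adj n
    inner i j = cut side i j ∧ (R i ∧ R j)

    demand : Fin n → Bool
    demand v = odd (degA inner v) xor target v
    open ParityJoin (parityJoin (cut-symmetric side) spanned demand) renaming (edges to J)

    J⇒inner : J ⇒ inner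
    J⇒inner i j Jij rewrite ⇒H i j Jij | inside i j Jij | inside j i (trans (symmetric j i) Jij) = refl

    -- As J ⊆ inner, K is inner with the edges of J removed.
    K : Adj n
    K i j = inner i j xor J i j

    K⇒inner : K ⇒ inner
    K⇒inner i j = xor-true-⊆ (J⇒inner i j)

    inner-parts : ∀ i j → inner i j ≡ true → cut side i j ≡ true × R i ≡ true × R j ≡ true
    inner-parts i j e with ∧-true⁻ {cut side i j} e
    ... | cut-ij , Rij = cut-ij , ∧-true⁻ Rij

    K⇒G : K ⇒ adj G
    K⇒G i j Kij = proj₁ (∧-true⁻ (proj₁ (inner-parts i j (K⇒inner i j Kij))))

    K-symmetric : Symmetric K
    K-symmetric i j = cong₂ _xor_ (cong₂ _∧_ (cut-symmetric side i j) (∧-comm (R i) (R j))) (symmetric i j)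

    K-irreflexive : Irreflexive K
    K-irreflexive i with K i i in Kii
    ... | false = refl
    ... | true  = ⊥-elim (true≢false (trans (sym (K⇒G i i Kii)) (irrefl G i)))

    K-isolated : ∀ v → R v ≡ false → ∀ j → K v j ≡ false
    K-isolated v Rv j with K v j in Kvj
    ... | false = refl
    ... | true  = ⊥-elim (true≢false (trans (sym (proj₁ (proj₂ (inner-parts v j (K⇒inner v j Kvj))))) Rv))

    K-parity-inside : ∀ v → R v ≡ true → v ≢ r₀ → odd (degA K v) ≡ target v
    K-parity-inside v Rv v≢r₀ = begin
      odd (degA K v)                 ≡⟨ odd-count-xor (inner v) (J v) ⟩
      d xor odd (degA J v)           ≡⟨ cong (d xor_) (parity v Rv v≢r₀) ⟩
      d xor (d xor target v)         ≡⟨ xor-assoc d d (target v) ⟨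
      (d xor d) xor target v         ≡⟨ cong (_xor target v) (xor-same d) ⟩
      target v                       ∎
      where
      open ≡-Reasoning
      d = odd (degA inner v)

    K-parity-outside : ∀ v → R v ≡ false → odd (degA K v) ≡ target v
    K-parity-outside v Rv = begin
      odd (degA K v)  ≡⟨ cong odd (trans (count-cong (K-isolated v Rv)) (count-false {n})) ⟩
      false           ≡⟨ cong (_∧ (side v xor b)) Rv ⟨
      target v        ∎
      where open ≡-Reasoning

    K-parity-off-root : ∀ v → v ≢ r₀ → odd (degA K v) ≡ target v
    K-parity-off-root v v≢r₀ with R v ≟ᵇ true
    ... | yes Rv = K-parity-inside v Rv v≢r₀
    ... | no  Rv = K-parity-outside v (¬-not Rv)
    -- At the root the demand is met by parity: odd K-degrees and odd targets are both even in number.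
    K-parity : ∀ v → odd (degA K v) ≡ target v
    K-parity v with v ≟ r₀
    ... | no  v≢r₀ = K-parity-off-root v v≢r₀
    ... | yes refl = odd-count-agree r₀ K-parity-off-root
                       (trans (handshake-parity K-symmetric K-irreflexive) (sym even))

    sides-differ : ∀ i j → K i j ≡ true → target i ≢ target j
    sides-differ i j Kij same with inner-parts i j (K⇒inner i j Kij)
    ... | cut-ij , Ri , Rj = true≢false (begin
      true                   ≡⟨ proj₂ (∧-true⁻ {adj G i j} cut-ij) ⟨
      side i xor side j      ≡⟨ cong (side i xor_) side-same ⟨
      side i xor side i      ≡⟨ xor-same (side i) ⟩
      false                  ∎)
      where
      open ≡-Reasoning
      side-same : side i ≡ side j
      side-same = xor-cancelʳ (side i) (side j) b
        (trans (sym (cong (_∧ (side i xor b)) Ri)) (trans same (cong (_∧ (side j xor b)) Rj)))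

    K-irregular : LocallyIrregularA K
    K-irregular = locallyIrregular-byParity target K-parity sides-differ

    removed-edge : ∀ a x q k → a ∧ not (((a ∧ x) ∧ q) xor k) ≡ true →
      (a ∧ not x) ∨ ((a ∧ not q) ∨ k) ≡ true
    removed-edge true false _     _ _ = refl
    removed-edge true true  false _ _ = refl
    removed-edge true true  true  k e = trans (sym (not-involutive k)) e

    removed-bound : pairCount (λ i j → adj G i j ∧ not (K i j))
                    ≤ pairCount (uncut side) + pairCount (outside R) + pred (count R)
    removed-bound = begin
      pairCount (λ i j → adj G i j ∧ not (K i j))
        ≤⟨ pairCount-mono (λ i j → removed-edge (adj G i j) (side i xor side j) (R i ∧ R j) (J i j)) ⟩
      pairCount (λ i j → uncut side i j ∨ (outside R i j ∨ J i j))
        ≤⟨ pairCount-∨ (uncut side) _ ⟩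
      pairCount (uncut side) + pairCount (λ i j → outside R i j ∨ J i j)
        ≤⟨ +-monoʳ-≤ (pairCount (uncut side)) (pairCount-∨ (outside R) J) ⟩
      pairCount (uncut side) + (pairCount (outside R) + pairCount J)
        ≡⟨ +-assoc (pairCount (uncut side)) _ _ ⟨
      pairCount (uncut side) + pairCount (outside R) + pairCount J
        ≤⟨ +-monoʳ-≤ (pairCount (uncut side) + pairCount (outside R)) (suc[m]≤n⇒m≤pred[n] small) ⟩
      pairCount (uncut side) + pairCount (outside R) + pred (count R) ∎
      where open ≤-Reasoning

    ieAtMost-subtree : IeAtMost G (pairCount (uncut side) + pairCount (outside R) + pred (count R))
    ieAtMost-subtree = ieAtMost-mono removed-bound (ieAtMost-subgraph G K K⇒G K-symmetric K-irregular)

-- Graphs with at least two vertices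

maxOf-upper : ∀ {k} (f : Fin k → ℕ) v → f v ≤ maxOf f
maxOf-upper f zero    = m≤m⊔n (f zero) _
maxOf-upper f (suc v) = ≤-trans (maxOf-upper (f ∘ suc) v) (m≤n⊔m (f zero) _)

module AtLeastTwoVertices {m} (G : Graph (suc (suc m))) (connected : Connected G) where
  open MaxCut G

  1≤maxDeg : 1 ≤ maxDeg G
  1≤maxDeg with connected zero (suc zero)
  ... | step {v = v} e _ = begin
    1              ≡⟨ count-singleton v ⟨
    count (_≡ᵇ v)  ≤⟨ count-mono neighbour ⟩
    deg G zero     ≤⟨ maxOf-upper (deg G) zero ⟩
    maxDeg G       ∎
    where
    open ≤-Reasoning
    neighbour : (_≡ᵇ v) ⊆ adj G zero
    neighbour j j≡v = subst (λ u → adj G zero u ≡ true) (sym (≡ᵇ-sound {i = j} j≡v)) e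

  ieAtMost-spanning : ∀ {R} → Spanned (cut side) zero R → count R ≡ suc (suc m) →
    ∀ b → odd (count (λ v → side v xor b)) ≡ false → IeAtMost G (pairCount (uncut side) + (m + 1))
  ieAtMost-spanning {R} spanned |R| b even =
    ieAtMost-mono (≤-reflexive shape) (Subtree.ieAtMost-subtree spanned b even-inside)
    where
    everything : ∀ v → R v ≡ true
    everything v = count-⊆⇒⊇ {p = R} {q = λ _ → true} (λ _ _ → refl)
                     (≤-reflexive (trans (count-true {suc (suc m)}) (sym |R|))) v refl
    even-inside : odd (count (λ v → R v ∧ (side v xor b))) ≡ false
    even-inside = trans (cong odd (count-cong (λ v → cong (_∧ (side v xor b)) (everything v)))) even
    nothing-outside : pairCount (outside R) ≡ 0
    nothing-outside = pairCount-empty (λ i j →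
      trans (cong (λ q → adj G i j ∧ not q) (cong₂ _∧_ (everything i) (everything j))) (∧-zeroʳ (adj G i j)))
    U = pairCount (uncut side)
    shape : U + pairCount (outside R) + pred (count R) ≡ U + (m + 1)
    shape = begin
      U + pairCount (outside R) + pred (count R)  ≡⟨ cong₂ (λ o k → U + o + pred k) nothing-outside |R| ⟩
      U + 0 + suc m                               ≡⟨ cong (_+ suc m) (+-identityʳ U) ⟩
      U + suc m                                   ≡⟨ cong (U +_) (+-comm 1 m) ⟩
      U + (m + 1)                                 ∎
      where open ≡-Reasoning

  ieAtMost-evenSide : ∀ b → odd (count (λ v → side v xor b)) ≡ false →
    IeAtMost G (pairCount (uncut side) + (m + 1))
  ieAtMost-evenSide =
    let _ , spanned , |R| = spanned-of-size connected zero (suc m) ≤-refl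
    in  ieAtMost-spanning spanned |R|

  -- x loses its at most Δ edges; b puts x on the odd side, whose rest is then even.
  ieAtMost-allButOne : ∀ {R x} → Spanned (cut side) zero R → count R ≡ suc m → R x ≡ false →
    (∀ b → odd (count (λ v → side v xor b)) ≡ true) → IeAtMost G (pairCount (uncut side) + (m + maxDeg G))
  ieAtMost-allButOne {R} {x} spanned |R| Rx odd-sides =
    ieAtMost-mono bound (Subtree.ieAtMost-subtree spanned (not (side x)) even-inside)
    where
    R⊆others : R ⊆ (λ v → not (v ≡ᵇ x))
    R⊆others v Rv with v ≟ x
    ... | yes refl = ⊥-elim (true≢false (trans (sym Rv) Rx))
    ... | no  _    = refl
    R≡others : ∀ v → R v ≡ not (v ≡ᵇ x)
    R≡others v with v ≟ x
    ... | yes refl = Rx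
    ... | no  v≢x  = count-⊆⇒⊇ R⊆others others≤R v (cong not (dec-false (v ≟ x) v≢x))
      where
      others≤R : count (λ v → not (v ≡ᵇ x)) ≤ count R
      others≤R = ≤-reflexive (suc-injective (trans (count-all-but x) (sym (cong suc |R|))))
    q : Fin (suc (suc m)) → Bool
    q v = side v xor not (side x)
    even-inside : odd (count (λ v → R v ∧ q v)) ≡ false
    even-inside = not-injective (begin
      odd (1 + rest)
        ≡⟨ cong (λ k → odd (k + rest)) x-on-odd-side ⟨
      odd (count (at-x q) + rest)
        ≡⟨ cong (λ k → odd (count (at-x q) + k)) (count-cong away-from-x) ⟨
      odd (count (at-x q) + count (λ v → q v ∧ not (v ≡ᵇ x)))
        ≡⟨ cong odd (count-split q (_≡ᵇ x)) ⟨
      odd (count q)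
        ≡⟨ odd-sides (not (side x)) ⟩
      true ∎)
      where
      open ≡-Reasoning
      rest : ℕ
      rest = count (λ v → R v ∧ q v)
      at-x : (Fin (suc (suc m)) → Bool) → Fin (suc (suc m)) → Bool
      at-x f v = f v ∧ (v ≡ᵇ x)
      x-on-odd-side : count (at-x q) ≡ 1
      x-on-odd-side = trans (count-∧-singleton q x) (cong indicator (xor-inverseʳ (side x)))
      away-from-x : ∀ v → q v ∧ not (v ≡ᵇ x) ≡ R v ∧ q v
      away-from-x v = trans (∧-comm (q v) _) (cong (_∧ q v) (sym (R≡others v)))
    outside⇒star : outside R ⇒ star x (adj G)
    outside⇒star i j e rewrite R≡others i | R≡others j with i ≟ x | j ≟ x
    ... | yes refl | yes refl = ⊥-elim (true≢false (trans (sym (proj₁ (∧-true⁻ e))) (irrefl G x)))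
    ... | yes refl | no  _    = trans (∧-identityʳ (adj G x j)) (proj₁ (∧-true⁻ e))
    ... | no  _    | yes refl = trans (∧-identityʳ (adj G i x)) (proj₁ (∧-true⁻ e))
    ... | no  _    | no  _    = e
    U = pairCount (uncut side)
    bound : U + pairCount (outside R) + pred (count R) ≤ U + (m + maxDeg G)
    bound = begin
      U + pairCount (outside R) + pred (count R)  ≡⟨ cong (λ k → U + pairCount (outside R) + pred k) |R| ⟩
      U + pairCount (outside R) + m               ≤⟨ +-monoˡ-≤ m (+-monoʳ-≤ U outside≤Δ) ⟩
      U + maxDeg G + m                            ≡⟨ +-assoc U (maxDeg G) m ⟩
      U + (maxDeg G + m)                          ≡⟨ cong (U +_) (+-comm (maxDeg G) m) ⟩
      U + (m + maxDeg G)                          ∎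
      where
      open ≤-Reasoning
      outside≤Δ : pairCount (outside R) ≤ maxDeg G
      outside≤Δ = begin
        pairCount (outside R)         ≤⟨ pairCount-mono outside⇒star ⟩
        pairCount (star x (adj G))    ≡⟨ pairCount-star (Graph.sym G) (irrefl G) x ⟩
        deg G x                       ≤⟨ maxOf-upper (deg G) x ⟩
        maxDeg G                      ∎

  ieAtMost-oddSides : (∀ b → odd (count (λ v → side v xor b)) ≡ true) →
    IeAtMost G (pairCount (uncut side) + (m + maxDeg G))
  ieAtMost-oddSides =
    let R , spanned , |R| = spanned-of-size connected zero m (≤-trans (n≤1+n _) ≤-refl)
        _ , Rx            = count<size⇒missing R (subst (_< suc (suc m)) (sym |R|) ≤-refl)
    in  ieAtMost-allButOne spanned |R| Rx

m+[2+n]+o∸2≡m+[n+o] : ∀ h m d → h + suc (suc m) + d ∸ 2 ≡ h + (m + d)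
m+[2+n]+o∸2≡m+[n+o] h m d = cong (_∸ 2) (begin
  h + suc (suc m) + d       ≡⟨ +-assoc h (suc (suc m)) d ⟩
  h + suc (suc (m + d))     ≡⟨ +-suc h (suc (m + d)) ⟩
  suc (h + suc (m + d))     ≡⟨ cong suc (+-suc h (m + d)) ⟩
  suc (suc (h + (m + d)))   ∎)
  where open ≡-Reasoning

theorem7 : ∀ {n} (G : Graph n) → 2 ≤ n → Connected G →
    IeAtMost G (size G / 2 + order G + maxDeg G ∸ 2)
theorem7 {suc (suc m)} G (s≤s (s≤s z≤n)) connected =
  subst (IeAtMost G) (sym (m+[2+n]+o∸2≡m+[n+o] (size G / 2) m (maxDeg G))) by-parity-of-sides
  where
  open MaxCut G
  open AtLeastTwoVertices G connected
  even-case : pairCount (uncut side) + (m + 1) ≤ size G / 2 + (m + maxDeg G)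
  even-case = +-mono-≤ uncut≤half (+-monoʳ-≤ m 1≤maxDeg)
  odd-case : pairCount (uncut side) + (m + maxDeg G) ≤ size G / 2 + (m + maxDeg G)
  odd-case = +-monoˡ-≤ (m + maxDeg G) uncut≤half
  by-parity-of-sides : IeAtMost G (size G / 2 + (m + maxDeg G))
  by-parity-of-sides with odd (count (λ v → side v xor false)) in odd₀
                        | odd (count (λ v → side v xor true))  in odd₁
  ... | false | _     = ieAtMost-mono even-case (ieAtMost-evenSide false odd₀)
  ... | true  | false = ieAtMost-mono even-case (ieAtMost-evenSide true odd₁)
  ... | true  | true  = ieAtMost-mono odd-case (ieAtMost-oddSides λ { false → odd₀ ; true → odd₁ })
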